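{- Let $m\ge1$ be an integer and let $a,b,f\in\mathbb{Z}[x]$ with $\deg a,\deg b<2m$, $\deg f<m$, $f(0)\neq0$ and $(ab)|_{2m}=f$. Then one of the following holds: (1) $ab=f$; (2) $ab\neq f$, $a|_m\cdot b|_m\neq f$ and $\|a|_m\|+\|b|_m\|\le\|a\|+\|b\|-1$; (3) $ab\neq f$, $a|_m\cdot b|_m=f$ and $\|a|_m\|+\|b|_m\|\le\|a\|+\|b\|-2$.
   Context: For $f\in\mathbb{Z}[x]$ and $m\in\mathbb{Z}_{\ge0}$, $f|_m$ denotes the remainder of $f$ upon division by $x^m$ (i.e. $f$ truncated to degree $<m$). $\|f\|$ is the sum of the squares of the coefficients of $f$. -}

module Defs where

open import Data.Nat using (ℕ; zero; suc; _≤_)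
open import Data.Integer using (ℤ; 0ℤ; _+_; _*_)
open import Data.List using (List; []; _∷_; take)
open import Relation.Binary.PropositionalEquality using (_≡_)

-- A polynomial in ℤ[x] is represented by its list of coefficients,
-- lowest degree first: a₀ ∷ a₁ ∷ … represents a₀ + a₁ x + ….
-- Trailing zeros are allowed; equality of polynomials is coefficientwise (_≈ₚ_).
Poly : Set
Poly = List ℤ

coeff : Poly → ℕ → ℤ
coeff []       _       = 0ℤ
coeff (c ∷ _)  zero    = c
coeff (_ ∷ cs) (suc i) = coeff cs i

_≈ₚ_ : Poly → Poly → Set
p ≈ₚ q = ∀ i → coeff p i ≡ coeff q i

DegLt : Poly → ℕ → Set
DegLt p k = ∀ i → k ≤ i → coeff p i ≡ 0ℤ

_+ₚ_ : Poly → Poly → Poly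
[]       +ₚ q        = q
(a ∷ as) +ₚ []       = a ∷ as
(a ∷ as) +ₚ (b ∷ bs) = (a + b) ∷ (as +ₚ bs)

scale : ℤ → Poly → Poly
scale c []       = []
scale c (b ∷ bs) = (c * b) ∷ scale c bs

_*ₚ_ : Poly → Poly → Poly
[]       *ₚ q = []
(a ∷ as) *ₚ q = scale a q +ₚ (0ℤ ∷ (as *ₚ q))

-- f|_m : remainder of f upon division by x^m
_∣ₜ_ : Poly → ℕ → Poly
f ∣ₜ m = take m f

‖_‖ : Poly → ℤ
‖ [] ‖     = 0ℤ
‖ c ∷ cs ‖ = c * c + ‖ cs ‖

module Submission where

-- Write a = a₀ + xᵐ·A and b = b₀ + xᵐ·B with a₀ = a|ₘ, b₀ = b|ₘ, so that
-- ‖a‖ = ‖a₀‖ + ‖A‖ and ‖b‖ = ‖b₀‖ + ‖B‖.  The theorem reduces to two facts.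
--
--  * If both tails vanish, then deg (ab) < 2m and ab agrees with f below x²ᵐ,
--    hence ab = f.  So if ab ≠ f some tail is nonzero, and its norm, an integer
--    sum of squares, is at least 1: this gives alternative (2).
--  * If a₀b₀ = f, then f(0) ≠ 0 forces a₀(0) ≠ 0.  When A = 0 the congruence
--    a₀·b ≡ ab ≡ f = a₀·b₀ (mod x²ᵐ) can be cancelled, because a power series
--    with nonzero constant term is not a zero divisor modulo xⁿ over ℤ; thus
--    b ≡ b₀ (mod x²ᵐ) and B = 0.  Hence if ab ≠ f and a₀b₀ = f, both tails
--    are nonzero and contribute at least 2: this gives alternative (3).

open import Defs
open import Data.Nat using (ℕ; _≤_) renaming (_*_ to _*ℕ_)
open import Data.Integer using (ℤ; 0ℤ; _+_; _-_; +_) renaming (_≤_ to _≤ℤ_)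
open import Data.Product using (_×_)
open import Data.Sum using (_⊎_)
open import Relation.Binary.PropositionalEquality using (_≢_)
open import Relation.Nullary using (¬_)

import Data.Nat as N
open N using (zero; suc; _<_; z≤n; s≤s; _<?_)
import Data.Nat.Properties as NP
open import Data.Integer using (-_; +[1+_]; -[1+_]; +≤+; _*_; _≟_; ≢-nonZero)
import Data.Integer.Properties as ZP
open import Data.Integer.Tactic.RingSolver using (solve-∀)
open import Algebra.Properties.AbelianGroup ZP.+-0-abelianGroup using (∙-cancelˡ)
open import Data.List using ([]; _∷_; drop)
open import Data.Product using (_,_)
open import Data.Sum using (inj₁; inj₂)
open import Data.Empty using (⊥-elim)
open import Relation.Nullary using (Dec; yes; no)
open import Relation.Nullary.Decidable using (map′)
open import Relation.Binary.PropositionalEquality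
  using (_≡_; refl; sym; trans; cong; cong₂; subst; subst₂; module ≡-Reasoning)
open ≡-Reasoning

EqMod : ℕ → Poly → Poly → Set
EqMod n p q = ∀ j → j < n → coeff p j ≡ coeff q j

EqMod-extend : ∀ {n p q} → EqMod n p q → coeff p n ≡ coeff q n → EqMod (suc n) p q
EqMod-extend {n} p≡q pₙ≡qₙ j j<1+n with NP.m<1+n⇒m<n∨m≡n j<1+n
... | inj₁ j<n  = p≡q j j<n
... | inj₂ refl = pₙ≡qₙ

coeff-+ : ∀ p q i → coeff (p +ₚ q) i ≡ coeff p i + coeff q i
coeff-+ []       q        i       = sym (ZP.+-identityˡ _)
coeff-+ (a ∷ as) []       i       = sym (ZP.+-identityʳ _)
coeff-+ (a ∷ as) (b ∷ bs) zero    = refl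
coeff-+ (a ∷ as) (b ∷ bs) (suc i) = coeff-+ as bs i

coeff-scale : ∀ c q i → coeff (scale c q) i ≡ c * coeff q i
coeff-scale c []       i       = sym (ZP.*-zeroʳ c)
coeff-scale c (b ∷ bs) zero    = refl
coeff-scale c (b ∷ bs) (suc i) = coeff-scale c bs i

coeff-*-cons : ∀ c p q i → coeff ((c ∷ p) *ₚ q) i ≡ c * coeff q i + coeff (0ℤ ∷ (p *ₚ q)) i
coeff-*-cons c p q i = trans (coeff-+ (scale c q) (0ℤ ∷ (p *ₚ q)) i)
                             (cong (_+ coeff (0ℤ ∷ (p *ₚ q)) i) (coeff-scale c q i))

coeff-*-const : ∀ p q → coeff (p *ₚ q) 0 ≡ coeff p 0 * coeff q 0
coeff-*-const []      q = sym (ZP.*-zeroˡ (coeff q 0))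
coeff-*-const (c ∷ p) q = trans (coeff-*-cons c p q 0) (ZP.+-identityʳ _)

coeff-*-consʳ : ∀ p c q i → coeff (p *ₚ (c ∷ q)) i ≡ c * coeff p i + coeff (0ℤ ∷ (p *ₚ q)) i
coeff-*-consʳ []      c q i       = sym (trans (cong (_+ coeff (0ℤ ∷ []) i) (ZP.*-zeroʳ c)) (zero-+ i))
  where
  zero-+ : ∀ i → 0ℤ + coeff (0ℤ ∷ []) i ≡ 0ℤ
  zero-+ zero    = refl
  zero-+ (suc i) = refl
coeff-*-consʳ (d ∷ p) c q zero    = begin
  coeff ((d ∷ p) *ₚ (c ∷ q)) 0  ≡⟨ coeff-*-const (d ∷ p) (c ∷ q) ⟩
  d * c                         ≡⟨ ZP.*-comm d c ⟩
  c * d                         ≡⟨ sym (ZP.+-identityʳ (c * d)) ⟩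
  c * d + 0ℤ                    ∎
coeff-*-consʳ (d ∷ p) c q (suc i) = begin
  coeff ((d ∷ p) *ₚ (c ∷ q)) (suc i)                    ≡⟨ coeff-*-cons d p (c ∷ q) (suc i) ⟩
  d * coeff q i + coeff (p *ₚ (c ∷ q)) i                ≡⟨ cong (_+_ (d * coeff q i)) (coeff-*-consʳ p c q i) ⟩
  d * coeff q i + (c * coeff p i + coeff (0ℤ ∷ (p *ₚ q)) i)
    ≡⟨ exchange (d * coeff q i) (c * coeff p i) (coeff (0ℤ ∷ (p *ₚ q)) i) ⟩
  c * coeff p i + (d * coeff q i + coeff (0ℤ ∷ (p *ₚ q)) i)
    ≡⟨ cong (_+_ (c * coeff p i)) (sym (coeff-*-cons d p q i)) ⟩
  c * coeff p i + coeff ((d ∷ p) *ₚ q) i                ∎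
  where
  exchange : ∀ x y z → x + (y + z) ≡ y + (x + z)
  exchange = solve-∀

-- p·0 = 0 (the zero polynomial is []; the recursion produces 0 ∷ 0 ∷ …).
*-zeroʳ : ∀ p i → coeff (p *ₚ []) i ≡ 0ℤ
*-zeroʳ []      i       = refl
*-zeroʳ (c ∷ p) zero    = refl
*-zeroʳ (c ∷ p) (suc i) = *-zeroʳ p i

*-comm : ∀ p q → (p *ₚ q) ≈ₚ (q *ₚ p)
*-comm []      q i = sym (*-zeroʳ q i)
*-comm (c ∷ p) q i = begin
  coeff ((c ∷ p) *ₚ q) i                  ≡⟨ coeff-*-cons c p q i ⟩
  c * coeff q i + coeff (0ℤ ∷ (p *ₚ q)) i ≡⟨ cong (_+_ (c * coeff q i)) (shifted i) ⟩
  c * coeff q i + coeff (0ℤ ∷ (q *ₚ p)) i ≡⟨ sym (coeff-*-consʳ q c p i) ⟩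
  coeff (q *ₚ (c ∷ p)) i                  ∎
  where
  shifted : ∀ i → coeff (0ℤ ∷ (p *ₚ q)) i ≡ coeff (0ℤ ∷ (q *ₚ p)) i
  shifted zero    = refl
  shifted (suc i) = *-comm p q i

*-local : ∀ p {q q'} n → EqMod (suc n) q q' → coeff (p *ₚ q) n ≡ coeff (p *ₚ q') n
*-local []      n       q≡q' = refl
*-local (c ∷ p) {q} {q'} n q≡q' = begin
  coeff ((c ∷ p) *ₚ q) n                   ≡⟨ coeff-*-cons c p q n ⟩
  c * coeff q n + coeff (0ℤ ∷ (p *ₚ q)) n   ≡⟨ cong₂ _+_ (cong (c *_) (q≡q' n NP.≤-refl)) (shifted n q≡q') ⟩
  c * coeff q' n + coeff (0ℤ ∷ (p *ₚ q')) n ≡⟨ sym (coeff-*-cons c p q' n) ⟩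
  coeff ((c ∷ p) *ₚ q') n                  ∎
  where
  shifted : ∀ n → EqMod (suc n) q q' → coeff (0ℤ ∷ (p *ₚ q)) n ≡ coeff (0ℤ ∷ (p *ₚ q')) n
  shifted zero    _    = refl
  shifted (suc n) q≡q' = *-local p n (λ j j<n → q≡q' j (NP.m<n⇒m<1+n j<n))

*-congʳ : ∀ p {q q'} → q ≈ₚ q' → (p *ₚ q) ≈ₚ (p *ₚ q')
*-congʳ p q≈q' n = *-local p n (λ j _ → q≈q' j)

*-congˡ : ∀ {p p'} q → p ≈ₚ p' → (p *ₚ q) ≈ₚ (p' *ₚ q)
*-congˡ {p} {p'} q p≈p' n = begin
  coeff (p *ₚ q) n  ≡⟨ *-comm p q n ⟩
  coeff (q *ₚ p) n  ≡⟨ *-congʳ q p≈p' n ⟩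
  coeff (q *ₚ p') n ≡⟨ *-comm q p' n ⟩
  coeff (p' *ₚ q) n ∎

-- If q ≡ q' (mod xⁿ), the n-th coefficients of p·q and p·q' differ exactly
-- by p(0)·(qₙ - q'ₙ); stated without subtraction.
*-last : ∀ p {q q'} n → EqMod n q q' →
  coeff (p *ₚ q) n + coeff p 0 * coeff q' n ≡ coeff (p *ₚ q') n + coeff p 0 * coeff q n
*-last []      {q} {q'} n       _    =
  cong (_+_ 0ℤ) (trans (ZP.*-zeroˡ (coeff q' n)) (sym (ZP.*-zeroˡ (coeff q n))))
*-last (c ∷ p) {q} {q'} zero    _    = begin
  coeff ((c ∷ p) *ₚ q) 0 + c * coeff q' 0   ≡⟨ cong (_+ c * coeff q' 0) (coeff-*-const (c ∷ p) q) ⟩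
  c * coeff q 0 + c * coeff q' 0            ≡⟨ ZP.+-comm (c * coeff q 0) (c * coeff q' 0) ⟩
  c * coeff q' 0 + c * coeff q 0            ≡⟨ cong (_+ c * coeff q 0) (sym (coeff-*-const (c ∷ p) q')) ⟩
  coeff ((c ∷ p) *ₚ q') 0 + c * coeff q 0   ∎
*-last (c ∷ p) {q} {q'} (suc n) q≡q' = begin
  coeff ((c ∷ p) *ₚ q) (suc n) + c * coeff q' (suc n)
    ≡⟨ cong (_+ c * coeff q' (suc n)) (coeff-*-cons c p q (suc n)) ⟩
  (c * coeff q (suc n) + coeff (p *ₚ q) n) + c * coeff q' (suc n)
    ≡⟨ cong (λ t → (c * coeff q (suc n) + t) + c * coeff q' (suc n)) (*-local p n q≡q') ⟩
  (c * coeff q (suc n) + coeff (p *ₚ q') n) + c * coeff q' (suc n)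
    ≡⟨ swap-outer (c * coeff q (suc n)) (coeff (p *ₚ q') n) (c * coeff q' (suc n)) ⟩
  (c * coeff q' (suc n) + coeff (p *ₚ q') n) + c * coeff q (suc n)
    ≡⟨ cong (_+ c * coeff q (suc n)) (sym (coeff-*-cons c p q' (suc n))) ⟩
  coeff ((c ∷ p) *ₚ q') (suc n) + c * coeff q (suc n) ∎
  where
  swap-outer : ∀ x y z → (x + y) + z ≡ (z + y) + x
  swap-outer = solve-∀

-- Cancellation modulo xⁿ: a polynomial with nonzero constant term is not a
-- zero divisor modulo xⁿ, since ℤ is an integral domain.
*-cancelˡ-mod : ∀ p {q q'} n → coeff p 0 ≢ 0ℤ → EqMod n (p *ₚ q) (p *ₚ q') → EqMod n q q'
*-cancelˡ-mod p zero    p₀≢0 pq≡pq' j ()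
*-cancelˡ-mod p {q} {q'} (suc n) p₀≢0 pq≡pq' = EqMod-extend {n} {q} {q'} below qₙ≡q'ₙ
  where
  below : EqMod n q q'
  below = *-cancelˡ-mod p n p₀≢0 (λ k k<n → pq≡pq' k (NP.m<n⇒m<1+n k<n))
  p₀q'ₙ≡p₀qₙ : coeff p 0 * coeff q' n ≡ coeff p 0 * coeff q n
  p₀q'ₙ≡p₀qₙ = ∙-cancelˡ (coeff (p *ₚ q) n) _ _ (begin
    coeff (p *ₚ q) n + coeff p 0 * coeff q' n  ≡⟨ *-last p n below ⟩
    coeff (p *ₚ q') n + coeff p 0 * coeff q n  ≡⟨ cong (_+ coeff p 0 * coeff q n) (sym (pq≡pq' n NP.≤-refl)) ⟩
    coeff (p *ₚ q) n + coeff p 0 * coeff q n   ∎)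
  qₙ≡q'ₙ : coeff q n ≡ coeff q' n
  qₙ≡q'ₙ = sym (ZP.*-cancelˡ-≡ (coeff p 0) _ _ {{≢-nonZero p₀≢0}} p₀q'ₙ≡p₀qₙ)

DegLt-* : ∀ p q k l → DegLt p k → DegLt q l → DegLt (p *ₚ q) (k N.+ l)
DegLt-* p       q zero    l p<0 q<l i _ = *-congˡ {p} {[]} q (λ i → p<0 i z≤n) i
DegLt-* []      q (suc k) l p<k q<l i _ = refl
DegLt-* (c ∷ p) q (suc k) l p<k q<l (suc i) (s≤s k+l≤i) = begin
  coeff ((c ∷ p) *ₚ q) (suc i)           ≡⟨ coeff-*-cons c p q (suc i) ⟩
  c * coeff q (suc i) + coeff (p *ₚ q) i ≡⟨ cong₂ _+_ (cong (c *_) (q<l (suc i) l≤1+i)) pq<k+l ⟩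
  c * 0ℤ + 0ℤ                           ≡⟨ cong (_+ 0ℤ) (ZP.*-zeroʳ c) ⟩
  0ℤ                                    ∎
  where
  l≤1+i : l ≤ suc i
  l≤1+i = NP.m≤n⇒m≤1+n (NP.m+n≤o⇒n≤o k k+l≤i)
  pq<k+l : coeff (p *ₚ q) i ≡ 0ℤ
  pq<k+l = DegLt-* p q k l (λ j k≤j → p<k (suc j) (s≤s k≤j)) q<l i k+l≤i

DegLt-mono : ∀ {p k l} → k ≤ l → DegLt p k → DegLt p l
DegLt-mono k≤l p<k i l≤i = p<k i (NP.≤-trans k≤l l≤i)

EqMod-DegLt : ∀ {n} p q → DegLt p n → DegLt q n → EqMod n p q → p ≈ₚ q
EqMod-DegLt {n} p q p<n q<n p≡q i with i <? n
... | yes i<n = p≡q i i<n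
... | no  i≮n = trans (p<n i (NP.≮⇒≥ i≮n)) (sym (q<n i (NP.≮⇒≥ i≮n)))

-- Truncation p|ₘ keeps the coefficients below m; drop m p is the tail
-- beyond xᵐ, so that p = p|ₘ + xᵐ·(drop m p).
coeff-take< : ∀ m p i → i < m → coeff (p ∣ₜ m) i ≡ coeff p i
coeff-take< (suc m) []       i       _         = refl
coeff-take< (suc m) (c ∷ cs) zero    _         = refl
coeff-take< (suc m) (c ∷ cs) (suc i) (s≤s i<m) = coeff-take< m cs i i<m

take-DegLt : ∀ m p → DegLt (p ∣ₜ m) m
take-DegLt zero    p        i       _         = refl
take-DegLt (suc m) []       i       _         = refl
take-DegLt (suc m) (c ∷ cs) (suc i) (s≤s m≤i) = take-DegLt m cs i m≤i

coeff-drop : ∀ m p i → coeff (drop m p) i ≡ coeff p (m N.+ i)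
coeff-drop zero    p        i = refl
coeff-drop (suc m) []       i = refl
coeff-drop (suc m) (c ∷ cs) i = coeff-drop m cs i

truncation-EqMod : ∀ n p q → (p ∣ₜ n) ≈ₚ q → EqMod n p q
truncation-EqMod n p q pₙ≈q j j<n = trans (sym (coeff-take< n p j j<n)) (pₙ≈q j)

truncate-DegLt : ∀ m p → DegLt p m → p ≈ₚ (p ∣ₜ m)
truncate-DegLt m p p<m = EqMod-DegLt p (p ∣ₜ m) p<m (take-DegLt m p) (λ j j<m → sym (coeff-take< m p j j<m))

tail-zero⇒DegLt : ∀ m p → (∀ i → coeff (drop m p) i ≡ 0ℤ) → DegLt p m
tail-zero⇒DegLt m p tail≡0 i m≤i = begin
  coeff p i                ≡⟨ cong (coeff p) (sym (NP.m+[n∸m]≡n m≤i)) ⟩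
  coeff p (m N.+ (i N.∸ m)) ≡⟨ sym (coeff-drop m p (i N.∸ m)) ⟩
  coeff (drop m p) (i N.∸ m) ≡⟨ tail≡0 (i N.∸ m) ⟩
  0ℤ                        ∎

sq-nonneg : ∀ c → 0ℤ ≤ℤ c * c
sq-nonneg (+ zero)   = +≤+ z≤n
sq-nonneg +[1+ n ]   = +≤+ z≤n
sq-nonneg -[1+ n ]   = +≤+ z≤n

norm-nonneg : ∀ p → 0ℤ ≤ℤ ‖ p ‖
norm-nonneg []       = +≤+ z≤n
norm-nonneg (c ∷ cs) = ZP.+-mono-≤ (sq-nonneg c) (norm-nonneg cs)

-- The norm is an integer sum of squares: either p = 0 or ‖p‖ ≥ 1.
zero-or-norm≥1 : ∀ p → (∀ i → coeff p i ≡ 0ℤ) ⊎ (+ 1 ≤ℤ ‖ p ‖)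
zero-or-norm≥1 []              = inj₁ (λ _ → refl)
zero-or-norm≥1 (+ zero ∷ cs) with zero-or-norm≥1 cs
... | inj₁ cs≡0 = inj₁ λ { zero → refl ; (suc i) → cs≡0 i }
... | inj₂ 1≤cs = inj₂ (subst (+ 1 ≤ℤ_) (sym (ZP.+-identityˡ ‖ cs ‖)) 1≤cs)
zero-or-norm≥1 (+[1+ n ] ∷ cs) = inj₂ (ZP.+-mono-≤ (+≤+ (s≤s z≤n)) (norm-nonneg cs))
zero-or-norm≥1 (-[1+ n ] ∷ cs) = inj₂ (ZP.+-mono-≤ (+≤+ (s≤s z≤n)) (norm-nonneg cs))

norm-split : ∀ m p → ‖ p ‖ ≡ ‖ p ∣ₜ m ‖ + ‖ drop m p ‖
norm-split zero    p        = sym (ZP.+-identityˡ _)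
norm-split (suc m) []       = refl
norm-split (suc m) (c ∷ cs) rewrite norm-split m cs = sym (ZP.+-assoc (c * c) _ _)

low-or-heavy-tail : ∀ m p → DegLt p m ⊎ (+ 1 ≤ℤ ‖ drop m p ‖)
low-or-heavy-tail m p with zero-or-norm≥1 (drop m p)
... | inj₁ tail≡0 = inj₁ (tail-zero⇒DegLt m p tail≡0)
... | inj₂ heavy  = inj₂ heavy

-- Polynomial equality is decidable (the statement's case split needs it);
-- trailing zeros are handled by comparing against 0.
≈ₚ-cons : ∀ {c d cs ds} → Dec (c ≡ d) → Dec (cs ≈ₚ ds) → Dec ((c ∷ cs) ≈ₚ (d ∷ ds))
≈ₚ-cons (yes c≡d) (yes cs≈ds) = yes λ { zero → c≡d ; (suc i) → cs≈ds i }
≈ₚ-cons (no  c≢d) _           = no (λ h → c≢d (h 0))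
≈ₚ-cons _         (no cs≉ds)  = no (λ h → cs≉ds (λ i → h (suc i)))

nil≈zero : [] ≈ₚ (0ℤ ∷ [])
nil≈zero zero    = refl
nil≈zero (suc i) = refl

≈ₚ-dec : ∀ p q → Dec (p ≈ₚ q)
≈ₚ-dec []       []       = yes (λ _ → refl)
≈ₚ-dec []       (d ∷ ds) = map′ (λ h i → trans (nil≈zero i) (h i)) (λ h i → trans (sym (nil≈zero i)) (h i))
                                (≈ₚ-cons (0ℤ ≟ d) (≈ₚ-dec [] ds))
≈ₚ-dec (c ∷ cs) []       = map′ (λ h i → trans (h i) (sym (nil≈zero i))) (λ h i → trans (h i) (nil≈zero i))
                                (≈ₚ-cons (c ≟ 0ℤ) (≈ₚ-dec cs []))
≈ₚ-dec (c ∷ cs) (d ∷ ds) = ≈ₚ-cons (c ≟ d) (≈ₚ-dec cs ds)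

low-factors-exact : ∀ m a b f → DegLt a m → DegLt b m → DegLt f m →
  EqMod (2 *ℕ m) (a *ₚ b) f → (a *ₚ b) ≈ₚ f
low-factors-exact m a b f a<m b<m f<m ab≡f =
  EqMod-DegLt (a *ₚ b) f (DegLt-mono {a *ₚ b} m+m≤2m (DegLt-* a b m m a<m b<m)) (DegLt-mono {f} (NP.m≤m+n m _) f<m) ab≡f
  where
  m+m≤2m : m N.+ m ≤ 2 *ℕ m
  m+m≤2m = NP.≤-reflexive (cong (m N.+_) (sym (NP.+-identityʳ m)))

-- If deg a < m, ab ≡ f (mod xⁿ) with deg b < n, and a|ₘ·b|ₘ = f with f(0) ≠ 0,
-- then a|ₘ(0) ≠ 0, and cancelling a|ₘ in a|ₘ·b ≡ ab ≡ a|ₘ·b|ₘ (mod xⁿ) gives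
-- b ≡ b|ₘ (mod xⁿ); hence deg b < m.
low-factor-forces-low : ∀ m n a b f → DegLt a m → DegLt b n → coeff f 0 ≢ 0ℤ →
  EqMod n (a *ₚ b) f → ((a ∣ₜ m) *ₚ (b ∣ₜ m)) ≈ₚ f → DegLt b m
low-factor-forces-low m n a b f a<m b<n f₀≢0 ab≡f a₀b₀≈f i m≤i with i <? n
... | no  i≮n = b<n i (NP.≮⇒≥ i≮n)
... | yes i<n = trans (b≡b₀ i i<n) (take-DegLt m b i m≤i)
  where
  a₀ b₀ : Poly
  a₀ = a ∣ₜ m
  b₀ = b ∣ₜ m
  a₀₀≢0 : coeff a₀ 0 ≢ 0ℤ
  a₀₀≢0 a₀₀≡0 = f₀≢0 (begin
    coeff f 0                ≡⟨ sym (a₀b₀≈f 0) ⟩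
    coeff (a₀ *ₚ b₀) 0       ≡⟨ coeff-*-const a₀ b₀ ⟩
    coeff a₀ 0 * coeff b₀ 0  ≡⟨ cong (_* coeff b₀ 0) a₀₀≡0 ⟩
    0ℤ * coeff b₀ 0          ≡⟨ ZP.*-zeroˡ (coeff b₀ 0) ⟩
    0ℤ                       ∎)
  a₀b≡a₀b₀ : EqMod n (a₀ *ₚ b) (a₀ *ₚ b₀)
  a₀b≡a₀b₀ k k<n = begin
    coeff (a₀ *ₚ b) k  ≡⟨ *-congˡ {a₀} {a} b (λ j → sym (truncate-DegLt m a a<m j)) k ⟩
    coeff (a *ₚ b) k   ≡⟨ ab≡f k k<n ⟩
    coeff f k          ≡⟨ sym (a₀b₀≈f k) ⟩
    coeff (a₀ *ₚ b₀) k ∎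
  b≡b₀ : EqMod n b b₀
  b≡b₀ = *-cancelˡ-mod a₀ n a₀₀≢0 a₀b≡a₀b₀

tailNorm : ℕ → Poly → Poly → ℤ
tailNorm m a b = ‖ drop m a ‖ + ‖ drop m b ‖

-- Since ‖a‖ = ‖a|ₘ‖ + ‖drop m a‖, tails of total norm ≥ k make the
-- truncations lighter by at least k.
truncation-norm-bound : ∀ m a b k → + k ≤ℤ tailNorm m a b →
  ‖ a ∣ₜ m ‖ + ‖ b ∣ₜ m ‖ ≤ℤ ‖ a ‖ + ‖ b ‖ - + k
truncation-norm-bound m a b k k≤tails rewrite norm-split m a | norm-split m b =
  subst₂ _≤ℤ_ (add-sub (‖ a ∣ₜ m ‖ + ‖ b ∣ₜ m ‖) (+ k))
              (regroup (‖ a ∣ₜ m ‖) (‖ b ∣ₜ m ‖) (‖ drop m a ‖) (‖ drop m b ‖) (+ k))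
              (ZP.+-monoˡ-≤ (- + k) (ZP.+-monoʳ-≤ (‖ a ∣ₜ m ‖ + ‖ b ∣ₜ m ‖) k≤tails))
  where
  add-sub : ∀ x k → x + k - k ≡ x
  add-sub = solve-∀
  regroup : ∀ x u y v k → (x + u) + (y + v) - k ≡ (x + y) + (u + v) - k
  regroup = solve-∀

module _ (m : ℕ) (a b f : Poly) (a<2m : DegLt a (2 *ℕ m)) (b<2m : DegLt b (2 *ℕ m))
         (f<m : DegLt f m) (f₀≢0 : coeff f 0 ≢ 0ℤ) (ab≡f : EqMod (2 *ℕ m) (a *ₚ b) f)
         (ab≉f : ¬ ((a *ₚ b) ≈ₚ f)) where

  some-tail-heavy : + 1 ≤ℤ tailNorm m a b
  some-tail-heavy with low-or-heavy-tail m a | low-or-heavy-tail m b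
  ... | inj₂ a-heavy | _            = ZP.+-mono-≤ a-heavy (norm-nonneg (drop m b))
  ... | inj₁ _       | inj₂ b-heavy = ZP.+-mono-≤ (norm-nonneg (drop m a)) b-heavy
  ... | inj₁ a<m     | inj₁ b<m     = ⊥-elim (ab≉f (low-factors-exact m a b f a<m b<m f<m ab≡f))

  both-tails-heavy : ((a ∣ₜ m) *ₚ (b ∣ₜ m)) ≈ₚ f → + 2 ≤ℤ tailNorm m a b
  both-tails-heavy a₀b₀≈f = ZP.+-mono-≤ a-heavy b-heavy
    where
    ba≡f : EqMod (2 *ℕ m) (b *ₚ a) f
    ba≡f j j<2m = trans (*-comm b a j) (ab≡f j j<2m)
    b₀a₀≈f : ((b ∣ₜ m) *ₚ (a ∣ₜ m)) ≈ₚ f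
    b₀a₀≈f j = trans (*-comm (b ∣ₜ m) (a ∣ₜ m) j) (a₀b₀≈f j)
    a-heavy : + 1 ≤ℤ ‖ drop m a ‖
    a-heavy with low-or-heavy-tail m a
    ... | inj₂ heavy = heavy
    ... | inj₁ a<m   = ⊥-elim (ab≉f (low-factors-exact m a b f a<m b<m f<m ab≡f))
      where
      b<m : DegLt b m
      b<m = low-factor-forces-low m (2 *ℕ m) a b f a<m b<2m f₀≢0 ab≡f a₀b₀≈f
    b-heavy : + 1 ≤ℤ ‖ drop m b ‖
    b-heavy with low-or-heavy-tail m b
    ... | inj₂ heavy = heavy
    ... | inj₁ b<m   = ⊥-elim (ab≉f (low-factors-exact m a b f a<m b<m f<m ab≡f))
      where
      a<m : DegLt a m
      a<m = low-factor-forces-low m (2 *ℕ m) b a f b<m a<2m f₀≢0 ba≡f b₀a₀≈f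

-- The theorem: decide whether ab = f and whether a|ₘ·b|ₘ = f; in the two
-- inexact cases the tails carry norm ≥ 1, resp. ≥ 2.
lemma4p3 : (m : ℕ) → 1 ≤ m → (a b f : Poly) →
    DegLt a (2 *ℕ m) → DegLt b (2 *ℕ m) → DegLt f m →
    coeff f 0 ≢ 0ℤ →
    ((a *ₚ b) ∣ₜ (2 *ℕ m)) ≈ₚ f →
    ((a *ₚ b) ≈ₚ f)
    ⊎ ((¬ ((a *ₚ b) ≈ₚ f)) × (¬ (((a ∣ₜ m) *ₚ (b ∣ₜ m)) ≈ₚ f)) ×
       (‖ a ∣ₜ m ‖ + ‖ b ∣ₜ m ‖ ≤ℤ ‖ a ‖ + ‖ b ‖ - + 1))
    ⊎ ((¬ ((a *ₚ b) ≈ₚ f)) × (((a ∣ₜ m) *ₚ (b ∣ₜ m)) ≈ₚ f) ×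
       (‖ a ∣ₜ m ‖ + ‖ b ∣ₜ m ‖ ≤ℤ ‖ a ‖ + ‖ b ‖ - + 2))
lemma4p3 m _ a b f a<2m b<2m f<m f₀≢0 ab|₂ₘ≈f
  with ≈ₚ-dec (a *ₚ b) f | ≈ₚ-dec ((a ∣ₜ m) *ₚ (b ∣ₜ m)) f
... | yes ab≈f | _          = inj₁ ab≈f
... | no ab≉f  | no a₀b₀≉f  = inj₂ (inj₁ (ab≉f , a₀b₀≉f , truncation-norm-bound m a b 1
        (some-tail-heavy m a b f a<2m b<2m f<m f₀≢0 (truncation-EqMod (2 *ℕ m) (a *ₚ b) f ab|₂ₘ≈f) ab≉f)))
... | no ab≉f  | yes a₀b₀≈f = inj₂ (inj₂ (ab≉f , a₀b₀≈f , truncation-norm-bound m a b 2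
        (both-tails-heavy m a b f a<2m b<2m f<m f₀≢0 (truncation-EqMod (2 *ℕ m) (a *ₚ b) f ab|₂ₘ≈f) ab≉f a₀b₀≈f)))
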